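{- Let $(u_{n-1},u_{n-2},\dots,u_0)$ be a chain of permutations in $S_n$ compatible with $(n-1,n-2,\dots,1)$ (i.e. for each $i\in[n-1]$ there is an increasing $i$-chain from $u_i$ to $u_{i-1}$) with $u_0=w_0$. Then $u_i\in S_n^{i\searrow}$ for every $i\in\{0,\dots,n-1\}$.
   Context: $w_0=[n,\dots,1]$. For $k\in\{0,\dots,n-1\}$, $S_n^{k\searrow}=\{w\in S_n: w(k+1)>\dots>w(n)\}$. $t_{i,j}$ is the transposition of $i<j$, $\ell$ the inversion number; $u\lessdot_k w$ if $w=ut_{i,j}$, $\ell(w)=\ell(u)+1$ and $i\le k<j$. An increasing $k$-chain is $(v_1,\dots,v_d)$ with $v_1\lessdot_k\cdots\lessdot_k v_d$ such that the smaller of the two values swapped at each step strictly increases along the chain ($d=1$ allowed). -}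

module Defs where

open import Data.Nat using (ℕ; zero; suc; _<_; _≤_; _⊓_)
open import Data.Nat.Properties using (_<?_)
open import Data.Fin using (Fin; toℕ; opposite)
open import Data.Fin.Permutation using (Permutation′; _⟨$⟩ʳ_; transpose)
open import Data.List using (List; length; filter; allFin; cartesianProduct)
open import Data.Product using (Σ; ∃; _×_; _,_; proj₁; proj₂)
open import Data.Maybe using (Maybe; just; nothing)
open import Data.Unit using (⊤)
open import Relation.Nullary.Decidable using (_×-dec_)
open import Relation.Binary.PropositionalEquality using (_≡_)

-- Permutations of S_n in one-line notation (0-indexed positions and values;
-- the shift by one preserves all order relations used below).
Perm : ℕ → Set
Perm n = Permutation′ n

_at_ : ∀ {n} → Perm n → Fin n → ℕ
w at p = toℕ (w ⟨$⟩ʳ p)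

IsW₀ : ∀ {n} → Perm n → Set
IsW₀ {n} w = ∀ (p : Fin n) → w ⟨$⟩ʳ p ≡ opposite p

inv : ∀ {n} → Perm n → ℕ
inv {n} w = length (filter (λ pq → (toℕ (proj₁ pq) <? toℕ (proj₂ pq))
                                   ×-dec (w at proj₂ pq <? w at proj₁ pq))
                           (cartesianProduct (allFin n) (allFin n)))

-- S_n^{k↘}: w(k+1) > … > w(n)  (1-indexed), i.e. w strictly decreasing on
-- 0-indexed positions k, …, n-1.
InDesc : ∀ {n} → ℕ → Perm n → Set
InDesc {n} k w = ∀ (p q : Fin n) → k ≤ toℕ p → toℕ p < toℕ q → w at q < w at p

-- u ⋖_k w via the transposition t_{i,j} (0-indexed positions p < q, which
-- correspond to 1-indexed i = p+1, j = q+1; i ≤ k < j ⇔ p < k ≤ q),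
-- where a is the smaller of the two values swapped.
CoverStep : ∀ {n} → ℕ → Perm n → Perm n → ℕ → Set
CoverStep {n} k u w a =
  Σ (Fin n) λ p → Σ (Fin n) λ q →
    toℕ p < toℕ q × toℕ p < k × k ≤ toℕ q
    × (∀ (x : Fin n) → w ⟨$⟩ʳ x ≡ u ⟨$⟩ʳ (transpose p q ⟨$⟩ʳ x))
    × inv w ≡ suc (inv u)
    × a ≡ (u at p) ⊓ (u at q)

Below : ℕ → Maybe ℕ → Set
Below a nothing  = ⊤
Below a (just b) = a < b

-- IncChain k u v m : an increasing k-chain (v₁ = u, …, v_d = v); m is the
-- smaller swapped value of the first step (nothing when d = 1).
data IncChain {n : ℕ} (k : ℕ) : Perm n → Perm n → Maybe ℕ → Set where
  single : ∀ {u} → IncChain k u u nothing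
  step   : ∀ {u w v a m} → CoverStep k u w a → IncChain k w v m → Below a m
         → IncChain k u v (just a)

IncreasingChain : ∀ {n} → ℕ → Perm n → Perm n → Set
IncreasingChain k u v = ∃ λ m → IncChain k u v m

-- If u ⋖ₖ w swaps positions p < k ≤ q, the cover condition ℓ(w) = ℓ(u) + 1 forces
-- u(p) < u(q) with no position strictly between p and q carrying a value strictly
-- between u(p) and u(q); otherwise the swap would decrease ℓ or raise it by more
-- than 1.  Since u and w agree on positions ≥ k except at q, where u(q) = w(p),
-- these two facts show that u is decreasing from position k on whenever w is.  So S_n^{k↘} is closed downwards along increasing k-chains, and
-- induction on i starting from w₀ ∈ S_n^{0↘} gives the corollary.
module Submission where

open import Defs
open import Data.Nat using (ℕ; zero; suc; _+_; _∸_; _≤_; _<_; z≤n; s≤s)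
open import Data.Nat.Properties
open import Algebra.Properties.CommutativeMonoid.Sum +-0-commutativeMonoid
  using (sum; ∑-distrib-+; sum-permute)
open import Algebra.Properties.CommutativeSemigroup +-commutativeSemigroup
  using (interchange; xy∙z≈xz∙y)
open import Data.Fin as Fin using (Fin; zero; suc; toℕ)
open import Data.Fin.Properties using (toℕ-injective; toℕ<n; opposite-prop)
  renaming (<⇒≢ to toℕ<⇒≢)
open import Data.Fin.Permutation using (_⟨$⟩ʳ_; _⟨$⟩ˡ_; transpose; inverseˡ)
open import Data.List using (length; filter; map; tabulate; cartesianProduct; _++_)
open import Data.List.Properties using (length-++; filter-++; map-tabulate)
open import Data.Product using (_×_; _,_; proj₁; proj₂)
open import Function using (_∘_; id)
open import Level using (0ℓ)
open import Relation.Binary using (tri<; tri≈; tri>)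
open import Relation.Binary.PropositionalEquality
open import Relation.Nullary using (Dec; yes; no; ¬_; contradiction)
open import Relation.Nullary.Decidable using (_×-dec_; dec-true; dec-false)
open import Relation.Unary using (Pred; Decidable)

m+m≤n+n⇒m≤n : ∀ {m n} → m + m ≤ n + n → m ≤ n
m+m≤n+n⇒m≤n {m} {n} m+m≤n+n = ≮⇒≥ (λ n<m → <⇒≱ (+-mono-< n<m n<m) m+m≤n+n)

sum-mono : ∀ {n} {f g : Fin n → ℕ} → (∀ i → f i ≤ g i) → sum f ≤ sum g
sum-mono {zero}  f≤g = z≤n
sum-mono {suc n} f≤g = +-mono-≤ (f≤g zero) (sum-mono (f≤g ∘ suc))

sum-mono-gap : ∀ {n} {f g : Fin n → ℕ} {k} (i : Fin n) →
  (∀ j → f j ≤ g j) → f i + k ≤ g i → sum f + k ≤ sum g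
sum-mono-gap {suc n} {f} {g} {k} zero f≤g gap = begin
  f zero + sum (f ∘ suc) + k   ≡⟨ xy∙z≈xz∙y (f zero) _ k ⟩
  f zero + k + sum (f ∘ suc)   ≤⟨ +-mono-≤ gap (sum-mono (f≤g ∘ suc)) ⟩
  g zero + sum (g ∘ suc)       ∎
  where open ≤-Reasoning
sum-mono-gap {suc n} {f} {g} {k} (suc i) f≤g gap = begin
  f zero + sum (f ∘ suc) + k   ≡⟨ +-assoc (f zero) _ k ⟩
  f zero + (sum (f ∘ suc) + k) ≤⟨ +-mono-≤ (f≤g zero) (sum-mono-gap i (f≤g ∘ suc) gap) ⟩
  g zero + sum (g ∘ suc)       ∎
  where open ≤-Reasoning

sum-mono-gap₂ : ∀ {n} {f g : Fin n → ℕ} {k l} (i j : Fin n) → i ≢ j →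
  (∀ b → f b ≤ g b) → f i + k ≤ g i → f j + l ≤ g j → sum f + (k + l) ≤ sum g
sum-mono-gap₂ zero zero i≢j = contradiction refl i≢j
sum-mono-gap₂ {f = f} {k = k} {l} zero (suc j) _ f≤g gapᵢ gapⱼ = begin
  f zero + sum (f ∘ suc) + (k + l)   ≡⟨ interchange (f zero) _ k l ⟩
  f zero + k + (sum (f ∘ suc) + l)   ≤⟨ +-mono-≤ gapᵢ (sum-mono-gap j (f≤g ∘ suc) gapⱼ) ⟩
  _                                  ∎
  where open ≤-Reasoning
sum-mono-gap₂ {f = f} {k = k} {l} (suc i) zero _ f≤g gapᵢ gapⱼ = begin
  f zero + sum (f ∘ suc) + (k + l)   ≡⟨ cong (f zero + sum (f ∘ suc) +_) (+-comm k l) ⟩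
  f zero + sum (f ∘ suc) + (l + k)   ≡⟨ interchange (f zero) _ l k ⟩
  f zero + l + (sum (f ∘ suc) + k)   ≤⟨ +-mono-≤ gapⱼ (sum-mono-gap i (f≤g ∘ suc) gapᵢ) ⟩
  _                                  ∎
  where open ≤-Reasoning
sum-mono-gap₂ {f = f} {k = k} {l} (suc i) (suc j) i≢j f≤g gapᵢ gapⱼ = begin
  f zero + sum (f ∘ suc) + (k + l)   ≡⟨ +-assoc (f zero) _ (k + l) ⟩
  f zero + (sum (f ∘ suc) + (k + l)) ≤⟨ +-mono-≤ (f≤g zero)
                                          (sum-mono-gap₂ i j (i≢j ∘ cong suc) (f≤g ∘ suc) gapᵢ gapⱼ) ⟩
  _                                  ∎
  where open ≤-Reasoning

transpose-applyˡ : ∀ {n} (p q : Fin n) → transpose p q ⟨$⟩ʳ p ≡ q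
transpose-applyˡ p q rewrite dec-true (p Fin.≟ p) refl = refl

transpose-applyʳ : ∀ {n} (p q : Fin n) → transpose p q ⟨$⟩ʳ q ≡ p
transpose-applyʳ p q with q Fin.≟ p
... | yes q≡p = q≡p
... | no  _   rewrite dec-true (q Fin.≟ q) refl = refl

transpose-apply-other : ∀ {n} {p q b : Fin n} → b ≢ p → b ≢ q → transpose p q ⟨$⟩ʳ b ≡ b
transpose-apply-other {p = p} {q} {b} b≢p b≢q
  rewrite dec-false (b Fin.≟ p) b≢p | dec-false (b Fin.≟ q) b≢q = refl

-- Symmetrising over σ = (p q) puts the two exceptional positions on the same
-- footing pointwise, at the price of counting everything twice.
sum-mono-except-pair : ∀ {n} {f g : Fin n → ℕ} {p q : Fin n} {k} → p ≢ q →
  (∀ {a} → a ≢ p → a ≢ q → f a ≤ g a) → f p + f q + k ≤ g p + g q → sum f + k ≤ sum g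
sum-mono-except-pair {n} {f} {g} {p} {q} {k} p≢q outside pair = m+m≤n+n⇒m≤n (begin
  sum f + k + (sum f + k)        ≡⟨ interchange (sum f) k (sum f) k ⟩
  sum f + sum f + (k + k)        ≡⟨ cong (_+ (k + k)) (sum-paired f) ⟨
  sum (paired f) + (k + k)       ≤⟨ sum-mono-gap₂ p q p≢q paired-mono paired-gap-p paired-gap-q ⟩
  sum (paired g)                 ≡⟨ sum-paired g ⟩
  sum g + sum g                  ∎)
  where
  open ≤-Reasoning
  σ = transpose p q

  paired : (Fin n → ℕ) → Fin n → ℕ
  paired h a = h a + h (σ ⟨$⟩ʳ a)

  sum-paired : ∀ h → sum (paired h) ≡ sum h + sum h
  sum-paired h = trans (∑-distrib-+ h _) (cong (sum h +_) (sym (sum-permute h σ)))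

  paired-gap-p : paired f p + k ≤ paired g p
  paired-gap-p rewrite transpose-applyˡ p q = pair

  paired-gap-q : paired f q + k ≤ paired g q
  paired-gap-q rewrite transpose-applyʳ p q | +-comm (f q) (f p) | +-comm (g q) (g p) = pair

  paired-mono : ∀ a → paired f a ≤ paired g a
  paired-mono a = by-cases (a Fin.≟ p) (a Fin.≟ q)
    where
    by-cases : Dec (a ≡ p) → Dec (a ≡ q) → paired f a ≤ paired g a
    by-cases (yes a≡p) _         = subst (λ c → paired f c ≤ paired g c) (sym a≡p) (m+n≤o⇒m≤o _ paired-gap-p)
    by-cases (no _)    (yes a≡q) = subst (λ c → paired f c ≤ paired g c) (sym a≡q) (m+n≤o⇒m≤o _ paired-gap-q)
    by-cases (no a≢p)  (no a≢q)  rewrite transpose-apply-other a≢p a≢q =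
      +-mono-≤ (outside a≢p a≢q) (outside a≢p a≢q)

indicator : ∀ {a} {A : Set a} → Dec A → ℕ
indicator (yes _) = 1
indicator (no _)  = 0

indicator-mono : ∀ {a b} {A : Set a} {B : Set b} → (A → B) →
  (a? : Dec A) (b? : Dec B) → indicator a? ≤ indicator b?
indicator-mono A⇒B (no _)  _       = z≤n
indicator-mono A⇒B (yes _) (yes _) = ≤-refl
indicator-mono A⇒B (yes a) (no ¬b) = contradiction (A⇒B a) ¬b

indicator-no : ∀ {a} {A : Set a} → ¬ A → (a? : Dec A) → indicator a? ≡ 0
indicator-no ¬a (yes a) = contradiction a ¬a
indicator-no ¬a (no _)  = refl

indicator-yes : ∀ {a} {A : Set a} → A → (a? : Dec A) → indicator a? ≡ 1
indicator-yes a (yes _) = refl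
indicator-yes a (no ¬a) = contradiction a ¬a

length-filter-tabulate : ∀ {A : Set} {P : Pred A 0ℓ} (P? : Decidable P) {n} (g : Fin n → A) →
  length (filter P? (tabulate g)) ≡ sum (indicator ∘ P? ∘ g)
length-filter-tabulate P? {zero}  g = refl
length-filter-tabulate P? {suc n} g with P? (g zero)
... | yes _ = cong suc (length-filter-tabulate P? (g ∘ suc))
... | no _  = length-filter-tabulate P? (g ∘ suc)

length-filter-cartesianProduct : ∀ {A B : Set} {P : Pred (A × B) 0ℓ} (P? : Decidable P)
  {m n} (f : Fin m → A) (g : Fin n → B) →
  length (filter P? (cartesianProduct (tabulate f) (tabulate g)))
    ≡ sum (λ a → sum (λ b → indicator (P? (f a , g b))))
length-filter-cartesianProduct P? {zero}  f g = refl
length-filter-cartesianProduct P? {suc m} f g = begin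
  length (filter P? (row ++ rest))               ≡⟨ cong length (filter-++ P? row rest) ⟩
  length (filter P? row ++ filter P? rest)       ≡⟨ length-++ (filter P? row) ⟩
  length (filter P? row) + length (filter P? rest)
    ≡⟨ cong₂ _+_ (trans (cong (length ∘ filter P?) (map-tabulate g (f zero ,_)))
                        (length-filter-tabulate P? (λ b → f zero , g b)))
                 (length-filter-cartesianProduct P? (f ∘ suc) g) ⟩
  _                                              ∎
  where
  open ≡-Reasoning
  row  = map (f zero ,_) (tabulate g)
  rest = cartesianProduct (tabulate (f ∘ suc)) (tabulate g)

Inversion : ∀ {n} → Perm n → Fin n → Fin n → Set
Inversion x a b = toℕ a < toℕ b × x at b < x at a

inversion? : ∀ {n} (x : Perm n) (a b : Fin n) → Dec (Inversion x a b)
inversion? x a b = (toℕ a <? toℕ b) ×-dec (x at b <? x at a)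

-- Opaque so that χ x a b stays rigid: otherwise unification sees through it into
-- the Dec proofs and can no longer recover x, a and b.
opaque
  χ : ∀ {n} → Perm n → Fin n → Fin n → ℕ
  χ x a b = indicator (inversion? x a b)

  χ-mono : ∀ {n} {x y : Perm n} {a b c d} → (Inversion x a b → Inversion y c d) → χ x a b ≤ χ y c d
  χ-mono {x = x} {y} {a} {b} {c} {d} imp = indicator-mono imp (inversion? x a b) (inversion? y c d)

  χ-no : ∀ {n} {x : Perm n} {a b} → ¬ Inversion x a b → χ x a b ≡ 0
  χ-no {x = x} {a} {b} ¬inv = indicator-no ¬inv (inversion? x a b)

  χ-yes : ∀ {n} {x : Perm n} {a b} → Inversion x a b → χ x a b ≡ 1
  χ-yes {x = x} {a} {b} inv = indicator-yes inv (inversion? x a b)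

  inv≡sum-χ : ∀ {n} (x : Perm n) → inv x ≡ sum (λ a → sum (χ x a))
  inv≡sum-χ x = length-filter-cartesianProduct (λ ab → inversion? x (proj₁ ab) (proj₂ ab)) id id

inversionsAt : ∀ {n} → Perm n → Fin n → ℕ
inversionsAt x a = sum (χ x a)

at-injective : ∀ {n} (x : Perm n) {a b : Fin n} → x at a ≡ x at b → a ≡ b
at-injective x {a} {b} xa≡xb = begin
  a                          ≡⟨ inverseˡ x ⟨
  x ⟨$⟩ˡ (x ⟨$⟩ʳ a)          ≡⟨ cong (x ⟨$⟩ˡ_) (toℕ-injective xa≡xb) ⟩
  x ⟨$⟩ˡ (x ⟨$⟩ʳ b)          ≡⟨ inverseˡ x ⟩
  b                          ∎
  where open ≡-Reasoning

record Swapped {n} (x y : Perm n) (p q : Fin n) : Set where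
  field
    at-p     : y at p ≡ x at q
    at-q     : y at q ≡ x at p
    at-other : ∀ {b} → b ≢ p → b ≢ q → y at b ≡ x at b

Swapped-sym : ∀ {n} {x y : Perm n} {p q} → Swapped x y p q → Swapped y x p q
Swapped-sym sw = record
  { at-p = sym at-q ; at-q = sym at-p ; at-other = λ b≢p b≢q → sym (at-other b≢p b≢q) }
  where open Swapped sw

∘transpose⇒Swapped : ∀ {n} {x y : Perm n} {p q} →
  (∀ b → y ⟨$⟩ʳ b ≡ x ⟨$⟩ʳ (transpose p q ⟨$⟩ʳ b)) → Swapped x y p q
∘transpose⇒Swapped {x = x} {y} {p} {q} y≗x∘σ = record
  { at-p     = via (transpose-applyˡ p q)
  ; at-q     = via (transpose-applyʳ p q)
  ; at-other = λ b≢p b≢q → via (transpose-apply-other b≢p b≢q)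
  }
  where
  via : ∀ {b c} → transpose p q ⟨$⟩ʳ b ≡ c → y at b ≡ x at c
  via {b} σb≡c = cong toℕ (trans (y≗x∘σ b) (cong (x ⟨$⟩ʳ_) σb≡c))

-- Swapping an ascent x(p) < x(q) into a descent compares the inversion counts row
-- by row: rows outside {p, q} do not lose, and rows p and q together gain one
-- inversion at column q, and one more at any column r with p < r < q and
-- x(p) < x(r) < x(q).
module SwapAscent {n} {x y : Perm n} {p q : Fin n} (sw : Swapped x y p q)
                  (p<q : toℕ p < toℕ q) (xp<xq : x at p < x at q) where
  open Swapped sw

  p≢q : p ≢ q
  p≢q = toℕ<⇒≢ p<q

  χ-outside : ∀ {a b} → a ≢ p → a ≢ q → b ≢ p → b ≢ q → χ x a b ≤ χ y a b
  χ-outside a≢p a≢q b≢p b≢q = χ-mono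
    (λ (a<b , xb<xa) → a<b , subst₂ _<_ (sym (at-other b≢p b≢q)) (sym (at-other a≢p a≢q)) xb<xa)

  χ-outside-pq : ∀ {a} → a ≢ p → a ≢ q → χ x a p + χ x a q ≤ χ y a p + χ y a q
  χ-outside-pq {a} a≢p a≢q = by-cases (toℕ a <? toℕ p)
    where
    ya≡xa : y at a ≡ x at a
    ya≡xa = at-other a≢p a≢q
    by-cases : Dec (toℕ a < toℕ p) → χ x a p + χ x a q ≤ χ y a p + χ y a q
    by-cases (yes a<p) = subst (χ x a p + χ x a q ≤_) (+-comm (χ y a q) _) (+-mono-≤
      (χ-mono (λ (_ , xp<xa) → <-trans a<p p<q , subst₂ _<_ (sym at-q) (sym ya≡xa) xp<xa))
      (χ-mono (λ (_ , xq<xa) → a<p , subst₂ _<_ (sym at-p) (sym ya≡xa) xq<xa)))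
    by-cases (no a≮p) = subst (λ c → c + χ x a q ≤ χ y a p + χ y a q) (sym (χ-no (a≮p ∘ proj₁)))
      (≤-trans (χ-mono (λ (a<q , xq<xa) → a<q , subst₂ _<_ (sym at-q) (sym ya≡xa) (<-trans xp<xq xq<xa)))
               (m≤n+m _ _))

  inversionsAt-outside : ∀ {a} → a ≢ p → a ≢ q → inversionsAt x a ≤ inversionsAt y a
  inversionsAt-outside {a} a≢p a≢q = subst (_≤ inversionsAt y a) (+-identityʳ _)
    (sum-mono-except-pair p≢q (χ-outside a≢p a≢q)
      (subst (_≤ χ y a p + χ y a q) (sym (+-identityʳ _)) (χ-outside-pq a≢p a≢q)))

  χ-row-p : ∀ b → χ x p b ≤ χ y p b
  χ-row-p b = χ-mono (λ (p<b , xb<xp) → p<b , subst₂ _<_ (sym (yb≡xb p<b xb<xp)) (sym at-p)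
                                                        (<-trans xb<xp xp<xq))
    where
    yb≡xb : toℕ p < toℕ b → x at b < x at p → y at b ≡ x at b
    yb≡xb p<b xb<xp = at-other (toℕ<⇒≢ p<b ∘ sym) (λ { refl → <-asym xb<xp xp<xq })

  χ-rows-pq : ∀ b → χ x p b + χ x q b ≤ χ y p b + χ y q b
  χ-rows-pq b = by-cases (toℕ q <? toℕ b)
    where
    by-cases : Dec (toℕ q < toℕ b) → χ x p b + χ x q b ≤ χ y p b + χ y q b
    by-cases (yes q<b) = subst (χ x p b + χ x q b ≤_) (+-comm (χ y q b) _) (+-mono-≤
      (χ-mono (λ (_ , xb<xp) → q<b , subst₂ _<_ (sym yb≡xb) (sym at-q) xb<xp))
      (χ-mono (λ (_ , xb<xq) → <-trans p<q q<b , subst₂ _<_ (sym yb≡xb) (sym at-p) xb<xq)))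
      where yb≡xb = at-other (toℕ<⇒≢ (<-trans p<q q<b) ∘ sym) (toℕ<⇒≢ q<b ∘ sym)
    by-cases (no q≮b) = subst (λ c → χ x p b + c ≤ χ y p b + χ y q b) (sym (χ-no (q≮b ∘ proj₁)))
      (subst (_≤ χ y p b + χ y q b) (sym (+-identityʳ _)) (≤-trans (χ-row-p b) (m≤m+n _ _)))

  χ-rows-pq-gain : ∀ {b} → ¬ Inversion x p b → ¬ Inversion x q b → Inversion y p b →
    χ x p b + χ x q b + 1 ≤ χ y p b + χ y q b
  χ-rows-pq-gain {b} ¬xpb ¬xqb ypb = begin
    χ x p b + χ x q b + 1   ≡⟨ cong₂ (λ s t → s + t + 1) (χ-no ¬xpb) (χ-no ¬xqb) ⟩
    1                       ≡⟨ χ-yes ypb ⟨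
    χ y p b                 ≤⟨ m≤m+n _ _ ⟩
    χ y p b + χ y q b       ∎
    where open ≤-Reasoning

  rows-pq-gain : ∀ {k} → sum (λ b → χ x p b + χ x q b) + k ≤ sum (λ b → χ y p b + χ y q b) →
    inversionsAt x p + inversionsAt x q + k ≤ inversionsAt y p + inversionsAt y q
  rows-pq-gain {k} = subst₂ (λ s t → s + k ≤ t) (∑-distrib-+ (χ x p) (χ x q)) (∑-distrib-+ (χ y p) (χ y q))

  gain-at-q : χ x p q + χ x q q + 1 ≤ χ y p q + χ y q q
  gain-at-q = χ-rows-pq-gain (λ (_ , xq<xp) → <-asym xq<xp xp<xq) (λ (q<q , _) → <-irrefl refl q<q)
                             (p<q , subst₂ _<_ (sym at-q) (sym at-p) xp<xq)

  gain-at-between : ∀ {r} → toℕ p < toℕ r → toℕ r < toℕ q → x at p < x at r → x at r < x at q →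
    χ x p r + χ x q r + 1 ≤ χ y p r + χ y q r
  gain-at-between {r} p<r r<q xp<xr xr<xq = χ-rows-pq-gain
    (λ (_ , xr<xp) → <-asym xr<xp xp<xr) (λ (q<r , _) → <-asym q<r r<q)
    (p<r , subst₂ _<_ (sym (at-other (toℕ<⇒≢ p<r ∘ sym) (toℕ<⇒≢ r<q))) (sym at-p) xr<xq)

  inv-gain : ∀ {k} → inversionsAt x p + inversionsAt x q + k ≤ inversionsAt y p + inversionsAt y q →
    inv x + k ≤ inv y
  inv-gain {k} rows-gain = subst₂ (λ s t → s + k ≤ t) (sym (inv≡sum-χ x)) (sym (inv≡sum-χ y))
    (sum-mono-except-pair p≢q inversionsAt-outside rows-gain)

  inv-swap-ascent : inv x + 1 ≤ inv y
  inv-swap-ascent = inv-gain (rows-pq-gain (sum-mono-gap q χ-rows-pq gain-at-q))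

  inv-swap-ascent-over : ∀ {r} → toℕ p < toℕ r → toℕ r < toℕ q → x at p < x at r → x at r < x at q →
    inv x + 2 ≤ inv y
  inv-swap-ascent-over p<r r<q xp<xr xr<xq = inv-gain (rows-pq-gain
    (sum-mono-gap₂ q _ (toℕ<⇒≢ r<q ∘ sym) χ-rows-pq gain-at-q (gain-at-between p<r r<q xp<xr xr<xq)))

module SwapCover {n} {u w : Perm n} {p q : Fin n} (sw : Swapped u w p q)
                 (p<q : toℕ p < toℕ q) (ℓw≡1+ℓu : inv w ≡ suc (inv u)) where
  open Swapped sw

  cover-ascent : u at p < u at q
  cover-ascent with <-cmp (u at p) (u at q)
  ... | tri< up<uq _ _ = up<uq
  ... | tri≈ _ up≡uq _ = contradiction (at-injective u up≡uq) (toℕ<⇒≢ p<q)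
  ... | tri> _ _ uq<up = contradiction (subst (_≤ inv u) ℓw≡1+ℓu (m+n≤o⇒m≤o _ ℓw+1≤ℓu)) (n≮n (inv u))
    where
    ℓw+1≤ℓu : inv w + 1 ≤ inv u
    ℓw+1≤ℓu = SwapAscent.inv-swap-ascent (Swapped-sym sw) p<q (subst₂ _<_ (sym at-p) (sym at-q) uq<up)

  cover-no-value-between : ∀ {r} → toℕ p < toℕ r → toℕ r < toℕ q → u at p < u at r → ¬ u at r < u at q
  cover-no-value-between p<r r<q up<ur ur<uq = n≮n (suc (inv u)) (begin-strict
    suc (inv u)   <⟨ n<1+n _ ⟩
    2 + inv u     ≡⟨ +-comm 2 (inv u) ⟩
    inv u + 2     ≤⟨ SwapAscent.inv-swap-ascent-over sw p<q cover-ascent p<r r<q up<ur ur<uq ⟩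
    inv w         ≡⟨ ℓw≡1+ℓu ⟩
    suc (inv u)   ∎)
    where open ≤-Reasoning

CoverStep-reflects-InDesc : ∀ {n} {k} {u w : Perm n} {a} → CoverStep k u w a → InDesc k w → InDesc k u
CoverStep-reflects-InDesc {k = k} {u} {w} (p , q , p<q , p<k , k≤q , w≗u∘σ , ℓw≡1+ℓu , _) w↘ P Q k≤P P<Q =
  by-cases (P Fin.≟ q) (Q Fin.≟ q)
  where
  sw : Swapped u w p q
  sw = ∘transpose⇒Swapped w≗u∘σ
  open Swapped sw
  open SwapCover sw p<q ℓw≡1+ℓu

  p<P : toℕ p < toℕ P
  p<P = <-≤-trans p<k k≤P

  by-cases : Dec (P ≡ q) → Dec (Q ≡ q) → u at Q < u at P
  by-cases (yes refl) _ = begin-strict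
    u at Q   ≡⟨ at-other (toℕ<⇒≢ (<-trans p<q P<Q) ∘ sym) (toℕ<⇒≢ P<Q ∘ sym) ⟨
    w at Q   <⟨ w↘ q Q k≤q P<Q ⟩
    w at q   ≡⟨ at-q ⟩
    u at p   <⟨ cover-ascent ⟩
    u at q   ∎
    where open ≤-Reasoning
  by-cases (no P≢q) (yes refl) = ≤∧≢⇒< (≮⇒≥ (cover-no-value-between p<P P<Q up<uP))
                                       (toℕ<⇒≢ P<Q ∘ sym ∘ at-injective u)
    where
    up<uP : u at p < u at P
    up<uP = subst₂ _<_ at-q (at-other (toℕ<⇒≢ p<P ∘ sym) P≢q) (w↘ P Q k≤P P<Q)
  by-cases (no P≢q) (no Q≢q) = subst₂ _<_ (at-other (toℕ<⇒≢ (<-trans p<P P<Q) ∘ sym) Q≢q)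
                                          (at-other (toℕ<⇒≢ p<P ∘ sym) P≢q) (w↘ P Q k≤P P<Q)

IncChain-reflects-InDesc : ∀ {n} {k} {u v : Perm n} {m} → IncChain k u v m → InDesc k v → InDesc k u
IncChain-reflects-InDesc single                  v↘ = v↘
IncChain-reflects-InDesc {k = k} (step {u} {w} {a = a} cover chain _) v↘ =
  CoverStep-reflects-InDesc {k = k} {u} {w} {a} cover (IncChain-reflects-InDesc chain v↘)

InDesc-weaken : ∀ {n} {k l} {x : Perm n} → k ≤ l → InDesc k x → InDesc l x
InDesc-weaken k≤l x↘ P Q l≤P = x↘ P Q (≤-trans k≤l l≤P)

IsW₀⇒InDesc : ∀ {n} {x : Perm n} → IsW₀ x → ∀ k → InDesc k x
IsW₀⇒InDesc {n} {x} x≗w₀ k P Q _ P<Q = subst₂ _<_ (sym (value Q)) (sym (value P))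
  (∸-monoʳ-< {n} (s≤s P<Q) (toℕ<n Q))
  where
  value : ∀ R → x at R ≡ n ∸ suc (toℕ R)
  value R = trans (cong toℕ (x≗w₀ R)) (opposite-prop R)

corollary3p8 : (n : ℕ) (u : ℕ → Perm n)
    → (∀ (i : ℕ) → 1 ≤ i → i < n → IncreasingChain i (u i) (u (i ∸ 1)))
    → IsW₀ (u 0)
    → ∀ (i : ℕ) → i < n → InDesc i (u i)
corollary3p8 n u chains u₀≡w₀ zero    _   = IsW₀⇒InDesc {x = u 0} u₀≡w₀ 0
corollary3p8 n u chains u₀≡w₀ (suc i) i<n = IncChain-reflects-InDesc (proj₂ (chains (suc i) (s≤s z≤n) i<n))
  (InDesc-weaken {x = u i} (n≤1+n i) (corollary3p8 n u chains u₀≡w₀ i (<-trans (n<1+n i) i<n)))
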